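{- Let $\mathbb F$ be a finite field of odd order and let $Q_{a,b}$ be a quadratic quasigroup upon $\mathbb F$ that is generated (as a quasigroup) by a set of at most two elements. Then at least one of the quasigroups $Q_{a,b}$ and $Q_{b,a}$ is generated by $\{0,1\}$.
   Context: $\chi$ is the quadratic character of $\mathbb F$. For $a,b\in\mathbb F$ with $\chi(a)=\chi(b)\ne0$ and $\chi(1-a)=\chi(1-b)\ne0$, $Q_{a,b}$ is $(\mathbb F,*)$ with $x*y=x+a(y-x)$ if $\chi(y-x)\ge0$ and $x*y=x+b(y-x)$ if $\chi(y-x)=-1$. -}

module Defs where

open import Level using (0ℓ)
open import Data.Nat using (ℕ) renaming (_+_ to _+ℕ_; _*_ to _*ℕ_)
open import Data.Fin using (Fin)
open import Data.Fin.Properties using (any?)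
open import Data.Integer using (ℤ; +_; -[1+_]; _≟_)
open import Data.Product using (∃; _,_; _×_)
import Data.Empty
open import Data.Sum using (_⊎_)
open import Data.Bool using (if_then_else_)
open import Relation.Nullary using (¬_; Dec; yes; no; does)
open import Relation.Binary.PropositionalEquality using (_≡_)
open import Algebra.Structures using (IsCommutativeRing)

record FiniteField : Set₁ where
  infixl 6 _+_
  infixl 7 _*_
  field
    Carrier : Set
    _+_ _*_ : Carrier → Carrier → Carrier
    -_ : Carrier → Carrier
    0# 1# : Carrier
    isCommutativeRing : IsCommutativeRing _≡_ _+_ _*_ -_ 0# 1#
    0≢1 : ¬ (0# ≡ 1#)
    inverse : ∀ x → ¬ (x ≡ 0#) → ∃ λ y → x * y ≡ 1#
    _≟F_ : (x y : Carrier) → Dec (x ≡ y)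
    size : ℕ
    enum : Fin size → Carrier
    enum-injective : ∀ i j → enum i ≡ enum j → i ≡ j
    enum-surjective : ∀ x → ∃ λ i → enum i ≡ x

  _-_ : Carrier → Carrier → Carrier
  x - y = x + (- y)

  IsSquare : Carrier → Set
  IsSquare x = ∃ λ y → y * y ≡ x

  isSquare? : ∀ x → Dec (IsSquare x)
  isSquare? x with any? (λ i → (enum i * enum i) ≟F x)
  ... | yes (i , p) = yes (enum i , p)
  ... | no ¬p = no λ { (y , q) → helper y q (enum-surjective y) }
    where
    helper : ∀ y → y * y ≡ x → (∃ λ i → enum i ≡ y) → Data.Empty.⊥
    helper .(enum i) q (i , _≡_.refl) = ¬p (i , q)

  χ : Carrier → ℤ
  χ x with x ≟F 0#
  ... | yes _ = + 0
  ... | no _ with isSquare? x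
  ...   | yes _ = + 1
  ...   | no _ = -[1+ 0 ]

  Qop : (a b : Carrier) → Carrier → Carrier → Carrier
  Qop a b x y =
    if does (χ (y - x) ≟ -[1+ 0 ]) then x + b * (y - x) else x + a * (y - x)

  -- a subset closed under the quasigroup operation and both divisions
  -- (divisions expressed relationally: x\z and z/y are the unique solutions)
  IsSubquasigroup : (a b : Carrier) → (Carrier → Set) → Set
  IsSubquasigroup a b T =
    (∀ x y → T x → T y → T (Qop a b x y)) ×
    (∀ x y → T x → T (Qop a b x y) → T y) ×
    (∀ x y → T y → T (Qop a b x y) → T x)

  InGenerated : (a b : Carrier) → (Carrier → Set) → Carrier → Set₁
  InGenerated a b S z =
    (T : Carrier → Set) → IsSubquasigroup a b T → (∀ w → S w → T w) → T z

  Generates : (a b : Carrier) → (Carrier → Set) → Set₁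
  Generates a b S = ∀ z → InGenerated a b S z

  pair : Carrier → Carrier → Carrier → Set
  pair u v w = (w ≡ u) ⊎ (w ≡ v)

  Admissible : Carrier → Carrier → Set
  Admissible a b =
    (χ a ≡ χ b) × ¬ (χ a ≡ + 0) × (χ (1# - a) ≡ χ (1# - b)) × ¬ (χ (1# - a) ≡ + 0)

HasOddOrder : FiniteField → Set
HasOddOrder F = ∃ λ k → FiniteField.size F ≡ 1 +ℕ 2 *ℕ k

-- A generating pair {u, v} consists of two distinct elements, because Q_{a,b} is
-- idempotent and cancellative, so every singleton is a subquasigroup. The dilation
-- w ↦ (w − u)/(v − u) sends u, v to 0, 1 and, χ being multiplicative, it is an
-- isomorphism Q_{a,b} → Q_{a,b} when v − u is a square and Q_{a,b} → Q_{b,a} when it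
-- is not; isomorphisms carry generating sets to generating sets.
{-# OPTIONS --safe #-}
module Submission where

open import Defs
open import Data.Nat using (suc)
open import Data.Nat.Properties using (1+n≰n)
open import Data.Fin using (Fin; punchOut) renaming (_<_ to _<ᶠ_)
open import Data.Fin.Properties using (any?; punchOut-injective; injective⇒≤; <-asym; <-cmp)
  renaming (_≟_ to _≟ᶠ_; _<?_ to _<ᶠ?_)
open import Data.Product using (∃; _×_; _,_; proj₁; proj₂)
open import Data.Sum using (_⊎_; inj₁; inj₂)
open import Data.Empty using (⊥-elim)
open import Data.Bool using (true; false; if_then_else_)
open import Data.Integer using (ℤ; 0ℤ; 1ℤ; -1ℤ) renaming (_*_ to _*ℤ_; _≟_ to _≟ℤ_)
import Data.Integer.Properties as ℤ
open import Function using (_∘_)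
open import Function.Definitions using (Injective)
open import Relation.Binary.Definitions using (tri<; tri≈; tri>)
open import Relation.Nullary using (¬_; Dec; yes; no; does)
open import Relation.Binary.PropositionalEquality
open import Algebra.Bundles using (CommutativeRing)

Fin-injective⇒surjective : ∀ {n} (f : Fin n → Fin n) → Injective _≡_ _≡_ f → ∀ j → ∃ λ i → f i ≡ j
Fin-injective⇒surjective {suc n} f f-inj j with any? (λ i → f i ≟ᶠ j)
... | yes hit = hit
... | no miss = ⊥-elim (1+n≰n (injective⇒≤ {f = f-punched} (f-inj ∘ punchOut-injective (f≢j _) (f≢j _))))
  where
  f≢j : ∀ i → j ≢ f i
  f≢j i j≡fi = miss (i , sym j≡fi)
  f-punched : Fin (suc n) → Fin n
  f-punched i = punchOut (f≢j i)

module Quadratic (F : FiniteField) where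
  open FiniteField F

  commutativeRing : CommutativeRing _ _
  commutativeRing = record { isCommutativeRing = isCommutativeRing }

  open CommutativeRing commutativeRing
    using (+-group; +-abelianGroup; +-identityʳ; -‿inverseˡ; -‿inverseʳ;
           *-comm; *-identityˡ; zeroˡ; zeroʳ; commutativeSemiring; ring)
  open import Algebra.Solver.Ring.NaturalCoefficients.Default commutativeSemiring
  open import Algebra.Properties.Group +-group
    using (x∙y⁻¹≈ε⇒x≈y; x≈y⇒x∙y⁻¹≈ε; inverseʳ-unique; identityʳ-unique; ∙-cancelˡ; ⁻¹-involutive)
  open import Algebra.Properties.AbelianGroup +-abelianGroup using (⁻¹-anti-homo‿-)
  open import Algebra.Properties.Ring ring using (-‿distribʳ-*; x[y-z]≈xy-xz; [y-z]x≈yx-zx)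
  open ≡-Reasoning

  x+[y-x]≡y : ∀ x y → x + (y - x) ≡ y
  x+[y-x]≡y x y = begin
    x + (y + - x)    ≡⟨ solve 3 (λ x y -x → x :+ (y :+ -x) := y :+ (-x :+ x)) refl x y (- x) ⟩
    y + (- x + x)    ≡⟨ cong (y +_) (-‿inverseˡ x) ⟩
    y + 0#           ≡⟨ +-identityʳ y ⟩
    y                ∎

  x-y≡0⇒x≡y : ∀ {x y} → x - y ≡ 0# → x ≡ y
  x-y≡0⇒x≡y {x} {y} = x∙y⁻¹≈ε⇒x≈y x y

  x*y≡0⇒x≡0∨y≡0 : ∀ x y → x * y ≡ 0# → x ≡ 0# ⊎ y ≡ 0#
  x*y≡0⇒x≡0∨y≡0 x y xy≡0 with x ≟F 0#
  ... | yes x≡0 = inj₁ x≡0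
  ... | no x≢0 with inverse x x≢0
  ... | x⁻¹ , xx⁻¹≡1 = inj₂ (begin
    y                ≡⟨ sym (*-identityˡ y) ⟩
    1# * y           ≡⟨ cong (_* y) (sym xx⁻¹≡1) ⟩
    (x * x⁻¹) * y    ≡⟨ solve 3 (λ x x⁻¹ y → (x :* x⁻¹) :* y := x⁻¹ :* (x :* y)) refl x x⁻¹ y ⟩
    x⁻¹ * (x * y)    ≡⟨ cong (x⁻¹ *_) xy≡0 ⟩
    x⁻¹ * 0#         ≡⟨ zeroʳ x⁻¹ ⟩
    0#               ∎)

  x≢0∧y≢0⇒x*y≢0 : ∀ {x y} → x ≢ 0# → y ≢ 0# → x * y ≢ 0#
  x≢0∧y≢0⇒x*y≢0 {x} {y} x≢0 y≢0 xy≡0 with x*y≡0⇒x≡0∨y≡0 x y xy≡0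
  ... | inj₁ x≡0 = x≢0 x≡0
  ... | inj₂ y≡0 = y≢0 y≡0

  x*x≡0⇒x≡0 : ∀ {x} → x * x ≡ 0# → x ≡ 0#
  x*x≡0⇒x≡0 {x} xx≡0 with x*y≡0⇒x≡0∨y≡0 x x xx≡0
  ... | inj₁ x≡0 = x≡0
  ... | inj₂ x≡0 = x≡0

  x*y≡1⇒y≢0 : ∀ {x y} → x * y ≡ 1# → y ≢ 0#
  x*y≡1⇒y≢0 {x} xy≡1 y≡0 = 0≢1 (trans (sym (zeroʳ x)) (trans (cong (x *_) (sym y≡0)) xy≡1))

  *-cancelˡ : ∀ {k x y} → k ≢ 0# → k * x ≡ k * y → x ≡ y
  *-cancelˡ {k} {x} {y} k≢0 kx≡ky with x*y≡0⇒x≡0∨y≡0 k (x - y) k[x-y]≡0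
    where
    k[x-y]≡0 : k * (x - y) ≡ 0#
    k[x-y]≡0 = begin
      k * (x - y)           ≡⟨ *-comm k (x - y) ⟩
      (x - y) * k           ≡⟨ [y-z]x≈yx-zx k x y ⟩
      (x * k) - (y * k)     ≡⟨ cong₂ _-_ (*-comm x k) (*-comm y k) ⟩
      (k * x) - (k * y)     ≡⟨ x≈y⇒x∙y⁻¹≈ε kx≡ky ⟩
      0#                    ∎
  ... | inj₁ k≡0 = ⊥-elim (k≢0 k≡0)
  ... | inj₂ x-y≡0 = x-y≡0⇒x≡y x-y≡0

  x*x≡y*y⇒y≡x∨y≡-x : ∀ x y → x * x ≡ y * y → y ≡ x ⊎ y ≡ - x
  x*x≡y*y⇒y≡x∨y≡-x x y xx≡yy with x*y≡0⇒x≡0∨y≡0 (x - y) (x + y) [x-y][x+y]≡0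
    where
    [x-y][x+y]≡0 : (x - y) * (x + y) ≡ 0#
    [x-y][x+y]≡0 = begin
      (x + - y) * (x + y)                ≡⟨ solve 3 (λ x y -y → (x :+ -y) :* (x :+ y) := (x :* x :+ y :* -y) :+ x :* (-y :+ y)) refl x y (- y) ⟩
      (x * x + y * - y) + x * (- y + y)  ≡⟨ cong₂ (λ p q → (x * x + p) + x * q) (sym (-‿distribʳ-* y y)) (-‿inverseˡ y) ⟩
      ((x * x) - (y * y)) + x * 0#         ≡⟨ cong₂ _+_ (x≈y⇒x∙y⁻¹≈ε xx≡yy) (zeroʳ x) ⟩
      0# + 0#                            ≡⟨ +-identityʳ 0# ⟩
      0#                                 ∎
  ... | inj₁ x-y≡0 = inj₁ (sym (x-y≡0⇒x≡y x-y≡0))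
  ... | inj₂ x+y≡0 = inj₂ (inverseʳ-unique x y x+y≡0)

  nonsquare⇒≢0 : ∀ {x} → ¬ IsSquare x → x ≢ 0#
  nonsquare⇒≢0 ¬□x x≡0 = ¬□x (0# , trans (zeroʳ 0#) (sym x≡0))

  isSquare-* : ∀ {x y} → IsSquare x → IsSquare y → IsSquare (x * y)
  isSquare-* {x} {y} (r , rr≡x) (s , ss≡y) = r * s , (begin
    (r * s) * (r * s)  ≡⟨ solve 2 (λ r s → (r :* s) :* (r :* s) := (r :* r) :* (s :* s)) refl r s ⟩
    (r * r) * (s * s)  ≡⟨ cong₂ _*_ rr≡x ss≡y ⟩
    x * y              ∎)

  isSquare-cancelˡ : ∀ {x y} → x ≢ 0# → IsSquare x → IsSquare (x * y) → IsSquare y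
  isSquare-cancelˡ {x} {y} x≢0 (r , rr≡x) (s , ss≡xy) with inverse r r≢0
    where
    r≢0 : r ≢ 0#
    r≢0 r≡0 = x≢0 (trans (sym rr≡x) (trans (cong (_* r) r≡0) (zeroˡ r)))
  ... | r⁻¹ , rr⁻¹≡1 = s * r⁻¹ , (begin
    (s * r⁻¹) * (s * r⁻¹)          ≡⟨ solve 2 (λ s r⁻¹ → (s :* r⁻¹) :* (s :* r⁻¹) := (s :* s) :* (r⁻¹ :* r⁻¹)) refl s r⁻¹ ⟩
    (s * s) * (r⁻¹ * r⁻¹)          ≡⟨ cong (_* (r⁻¹ * r⁻¹)) (trans ss≡xy (cong (_* y) (sym rr≡x))) ⟩
    ((r * r) * y) * (r⁻¹ * r⁻¹)    ≡⟨ solve 3 (λ r y r⁻¹ → ((r :* r) :* y) :* (r⁻¹ :* r⁻¹) := ((r :* r⁻¹) :* (r :* r⁻¹)) :* y) refl r y r⁻¹ ⟩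
    ((r * r⁻¹) * (r * r⁻¹)) * y    ≡⟨ cong (λ e → (e * e) * y) rr⁻¹≡1 ⟩
    (1# * 1#) * y                  ≡⟨ cong (_* y) (*-identityˡ 1#) ⟩
    1# * y                         ≡⟨ *-identityˡ y ⟩
    y                              ∎)

  index : Carrier → Fin size
  index x = proj₁ (enum-surjective x)

  enum-index : ∀ x → enum (index x) ≡ x
  enum-index x = proj₂ (enum-surjective x)

  index-injective : Injective _≡_ _≡_ index
  index-injective {x} {y} ix≡iy = trans (sym (enum-index x)) (trans (cong enum ix≡iy) (enum-index y))

  injective⇒surjective : (f : Carrier → Carrier) → Injective _≡_ _≡_ f → ∀ z → ∃ λ x → f x ≡ z
  injective⇒surjective f f-inj z with Fin-injective⇒surjective (index ∘ f ∘ enum) g-inj (index z)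
    where
    g-inj : Injective _≡_ _≡_ (index ∘ f ∘ enum)
    g-inj = enum-injective _ _ ∘ f-inj ∘ index-injective
  ... | i , fi≡z = enum i , index-injective fi≡z

  -- Positive picks one element from each pair {x, − x} with x ≢ − x. For a nonsquare k,
  -- x ↦ ± x² (with the sign k when x is not positive) is then injective, hence onto,
  -- so every element is a square or k times a square.
  Positive : Carrier → Set
  Positive x = index x <ᶠ index (- x)

  positive? : ∀ x → Dec (Positive x)
  positive? x = index x <ᶠ? index (- x)

  module _ {k : Carrier} (¬□k : ¬ IsSquare k) where

    square≡k*square⇒≡0 : ∀ {x y} → x * x ≡ k * (y * y) → x ≡ 0# × y ≡ 0#
    square≡k*square⇒≡0 {x} {y} xx≡kyy with y ≟F 0#
    ... | no y≢0 = ⊥-elim (¬□k (isSquare-cancelˡ (x≢0∧y≢0⇒x*y≢0 y≢0 y≢0) (y , refl) □[yy]k))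
      where □[yy]k = x , trans xx≡kyy (*-comm k (y * y))
    ... | yes refl = x*x≡0⇒x≡0 (trans xx≡kyy (trans (cong (k *_) (zeroʳ 0#)) (zeroʳ k))) , refl

    signedSquare : Carrier → Carrier
    signedSquare x with positive? x
    ... | yes _ = x * x
    ... | no _  = k * (x * x)

    signedSquare-injective : Injective _≡_ _≡_ signedSquare
    signedSquare-injective {x} {y} e with positive? x | positive? y
    ... | yes x>0 | yes y>0 = same-sign x>0 y>0 (x*x≡y*y⇒y≡x∨y≡-x x y e)
      where
      same-sign : Positive x → Positive y → y ≡ x ⊎ y ≡ - x → x ≡ y
      same-sign _ _ (inj₁ y≡x) = sym y≡x
      same-sign x>0 y>0 (inj₂ refl) =
        ⊥-elim (<-asym x>0 (subst (λ z → index (- x) <ᶠ index z) (⁻¹-involutive x) y>0))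
    ... | no x≯0 | no y≯0 = same-sign x≯0 y≯0 (x*x≡y*y⇒y≡x∨y≡-x x y (*-cancelˡ (nonsquare⇒≢0 ¬□k) e))
      where
      same-sign : ¬ Positive x → ¬ Positive y → y ≡ x ⊎ y ≡ - x → x ≡ y
      same-sign _ _ (inj₁ y≡x) = sym y≡x
      same-sign x≯0 y≯0 (inj₂ refl) with <-cmp (index x) (index (- x))
      ... | tri< x>0 _ _ = ⊥-elim (x≯0 x>0)
      ... | tri≈ _ ix≡i-x _ = index-injective ix≡i-x
      ... | tri> _ _ -x>0 = ⊥-elim (y≯0 (subst (λ z → index (- x) <ᶠ index z) (sym (⁻¹-involutive x)) -x>0))
    ... | yes _ | no _ = let (x≡0 , y≡0) = square≡k*square⇒≡0 e in trans x≡0 (sym y≡0)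
    ... | no _ | yes _ = let (y≡0 , x≡0) = square≡k*square⇒≡0 (sym e) in trans x≡0 (sym y≡0)

    square⊎k*square : ∀ t → IsSquare t ⊎ ∃ λ x → k * (x * x) ≡ t
    square⊎k*square t with injective⇒surjective signedSquare signedSquare-injective t
    ... | x , x±²≡t with positive? x
    ... | yes _ = inj₁ (x , x±²≡t)
    ... | no _  = inj₂ (x , x±²≡t)

    nonsquare*nonsquare : ∀ {t} → ¬ IsSquare t → IsSquare (k * t)
    nonsquare*nonsquare {t} ¬□t with square⊎k*square t
    ... | inj₁ □t = ⊥-elim (¬□t □t)
    ... | inj₂ (x , kxx≡t) = k * x , (begin
      (k * x) * (k * x)  ≡⟨ solve 2 (λ k x → (k :* x) :* (k :* x) := k :* (k :* (x :* x))) refl k x ⟩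
      k * (k * (x * x))  ≡⟨ cong (k *_) kxx≡t ⟩
      k * t              ∎)

  χ-zero : χ 0# ≡ 0ℤ
  χ-zero with 0# ≟F 0#
  ... | yes _ = refl
  ... | no 0≢0 = ⊥-elim (0≢0 refl)

  χ-square : ∀ {x} → x ≢ 0# → IsSquare x → χ x ≡ 1ℤ
  χ-square {x} x≢0 □x with x ≟F 0#
  ... | yes x≡0 = ⊥-elim (x≢0 x≡0)
  ... | no _ with isSquare? x
  ... | yes _ = refl
  ... | no ¬□x = ⊥-elim (¬□x □x)

  χ-nonsquare : ∀ {x} → ¬ IsSquare x → χ x ≡ -1ℤ
  χ-nonsquare {x} ¬□x with x ≟F 0#
  ... | yes x≡0 = ⊥-elim (nonsquare⇒≢0 ¬□x x≡0)
  ... | no _ with isSquare? x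
  ... | yes □x = ⊥-elim (¬□x □x)
  ... | no _ = refl

  χ-* : ∀ x y → χ (x * y) ≡ χ x *ℤ χ y
  χ-* x y = by-cases (x ≟F 0#) (y ≟F 0#) (isSquare? x) (isSquare? y)
    where
    by-cases : Dec (x ≡ 0#) → Dec (y ≡ 0#) → Dec (IsSquare x) → Dec (IsSquare y) → χ (x * y) ≡ χ x *ℤ χ y
    by-cases (yes x≡0) _ _ _ = begin
      χ (x * y)      ≡⟨ cong χ (trans (cong (_* y) x≡0) (zeroˡ y)) ⟩
      χ 0#           ≡⟨ χ-zero ⟩
      0ℤ *ℤ χ y     ≡⟨ cong (_*ℤ χ y) (trans (sym χ-zero) (cong χ (sym x≡0))) ⟩
      χ x *ℤ χ y     ∎
    by-cases (no _) (yes y≡0) _ _ = begin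
      χ (x * y)      ≡⟨ cong χ (trans (cong (x *_) y≡0) (zeroʳ x)) ⟩
      χ 0#           ≡⟨ χ-zero ⟩
      0ℤ            ≡⟨ sym (ℤ.*-zeroʳ (χ x)) ⟩
      χ x *ℤ 0ℤ     ≡⟨ cong (χ x *ℤ_) (trans (sym χ-zero) (cong χ (sym y≡0))) ⟩
      χ x *ℤ χ y     ∎
    by-cases (no x≢0) (no y≢0) (yes □x) (yes □y)
      rewrite χ-square x≢0 □x | χ-square y≢0 □y = χ-square (x≢0∧y≢0⇒x*y≢0 x≢0 y≢0) (isSquare-* □x □y)
    by-cases (no x≢0) (no _) (yes □x) (no ¬□y)
      rewrite χ-square x≢0 □x | χ-nonsquare ¬□y = χ-nonsquare (¬□y ∘ isSquare-cancelˡ x≢0 □x)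
    by-cases (no _) (no y≢0) (no ¬□x) (yes □y)
      rewrite χ-nonsquare ¬□x | χ-square y≢0 □y = χ-nonsquare (¬□x ∘ isSquare-cancelˡ y≢0 □y ∘ subst IsSquare (*-comm x y))
    by-cases (no x≢0) (no y≢0) (no ¬□x) (no ¬□y)
      rewrite χ-nonsquare ¬□x | χ-nonsquare ¬□y = χ-square (x≢0∧y≢0⇒x*y≢0 x≢0 y≢0) (nonsquare*nonsquare ¬□x ¬□y)

  χ≢0⇒≢0 : ∀ {x} → χ x ≢ 0ℤ → x ≢ 0#
  χ≢0⇒≢0 χx≢0 x≡0 = χx≢0 (trans (cong χ x≡0) χ-zero)

  slope : Carrier → Carrier → ℤ → Carrier
  slope a b c = if does (c ≟ℤ -1ℤ) then b else a

  slope-elim : (P : Carrier → Set) → ∀ {a b} → P a → P b → ∀ c → P (slope a b c)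
  slope-elim P pa pb c with does (c ≟ℤ -1ℤ)
  ... | true  = pb
  ... | false = pa

  Qop-slope : ∀ a b x y → Qop a b x y ≡ x + slope a b (χ (y - x)) * (y - x)
  Qop-slope a b x y with does (χ (y - x) ≟ℤ -1ℤ)
  ... | true  = refl
  ... | false = refl

  module _ {a b : Carrier} where

    Qop-idem : ∀ x → Qop a b x x ≡ x
    Qop-idem x = begin
      Qop a b x x                              ≡⟨ Qop-slope a b x x ⟩
      x + slope a b (χ (x - x)) * (x - x)      ≡⟨ cong (λ e → x + slope a b (χ (x - x)) * e) (-‿inverseʳ x) ⟩
      x + slope a b (χ (x - x)) * 0#           ≡⟨ cong (x +_) (zeroʳ _) ⟩
      x + 0#                                   ≡⟨ +-identityʳ x ⟩
      x                                        ∎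

    Qop-cancelˡ : a ≢ 0# → b ≢ 0# → ∀ {x y} → Qop a b x y ≡ x → y ≡ x
    Qop-cancelˡ a≢0 b≢0 {x} {y} xy≡x
      with x*y≡0⇒x≡0∨y≡0 s (y - x) (identityʳ-unique x (s * (y - x)) (trans (sym (Qop-slope a b x y)) xy≡x))
      where s = slope a b (χ (y - x))
    ... | inj₁ s≡0 = ⊥-elim (slope-elim (_≢ 0#) a≢0 b≢0 (χ (y - x)) s≡0)
    ... | inj₂ y-x≡0 = x-y≡0⇒x≡y y-x≡0

    Qop-cancelʳ : 1# - a ≢ 0# → 1# - b ≢ 0# → ∀ {x y} → Qop a b x y ≡ y → x ≡ y
    Qop-cancelʳ 1-a≢0 1-b≢0 {x} {y} xy≡y with x*y≡0⇒x≡0∨y≡0 (1# - s) (y - x) [1-s][y-x]≡0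
      where
      s = slope a b (χ (y - x))
      s[y-x]≡y-x : s * (y - x) ≡ y - x
      s[y-x]≡y-x = ∙-cancelˡ x _ _ (trans (sym (Qop-slope a b x y)) (trans xy≡y (sym (x+[y-x]≡y x y))))
      [1-s][y-x]≡0 : (1# - s) * (y - x) ≡ 0#
      [1-s][y-x]≡0 = begin
        (1# - s) * (y - x)                ≡⟨ [y-z]x≈yx-zx (y - x) 1# s ⟩
        (1# * (y - x)) - (s * (y - x))    ≡⟨ cong₂ _-_ (*-identityˡ (y - x)) s[y-x]≡y-x ⟩
        (y - x) - (y - x)                 ≡⟨ -‿inverseʳ (y - x) ⟩
        0#                                ∎
    ... | inj₁ 1-s≡0 = ⊥-elim (slope-elim (λ s → 1# - s ≢ 0#) 1-a≢0 1-b≢0 (χ (y - x)) 1-s≡0)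
    ... | inj₂ y-x≡0 = sym (x-y≡0⇒x≡y y-x≡0)

    singleton-isSubquasigroup : Admissible a b → ∀ u → IsSubquasigroup a b (_≡ u)
    singleton-isSubquasigroup (χa≡χb , χa≢0 , χ1-a≡χ1-b , χ1-a≢0) u =
      (λ { x .x refl refl → Qop-idem x }) ,
      (λ { x y refl xy≡x → Qop-cancelˡ a≢0 b≢0 xy≡x }) ,
      (λ { x y refl xy≡y → Qop-cancelʳ 1-a≢0 1-b≢0 xy≡y })
      where
      a≢0 = χ≢0⇒≢0 χa≢0
      b≢0 = χ≢0⇒≢0 (subst (_≢ 0ℤ) χa≡χb χa≢0)
      1-a≢0 = χ≢0⇒≢0 χ1-a≢0
      1-b≢0 = χ≢0⇒≢0 (subst (_≢ 0ℤ) χ1-a≡χ1-b χ1-a≢0)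

    generators-distinct : Admissible a b → ∀ {u v} → Generates a b (pair u v) → u ≢ v
    generators-distinct adm {u} gen u≡v = 0≢1 (trans (all≡u 0#) (sym (all≡u 1#)))
      where
      all≡u : ∀ z → z ≡ u
      all≡u z = gen z (_≡ u) (singleton-isSubquasigroup adm u) λ { w (inj₁ w≡u) → w≡u ; w (inj₂ w≡v) → trans w≡v (sym u≡v) }

  IsHom : (a b a' b' : Carrier) → (Carrier → Carrier) → Set
  IsHom a b a' b' ψ = ∀ x y → ψ (Qop a b x y) ≡ Qop a' b' (ψ x) (ψ y)

  module _ {a b a' b' : Carrier} {ψ : Carrier → Carrier} (ψ-hom : IsHom a b a' b' ψ) where

    preimage-isSubquasigroup : ∀ {T} → IsSubquasigroup a' b' T → IsSubquasigroup a b (T ∘ ψ)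
    preimage-isSubquasigroup {T} (closed , divˡ , divʳ) =
      (λ x y Tψx Tψy → subst T (sym (ψ-hom x y)) (closed (ψ x) (ψ y) Tψx Tψy)) ,
      (λ x y Tψx Tψxy → divˡ (ψ x) (ψ y) Tψx (subst T (ψ-hom x y) Tψxy)) ,
      (λ x y Tψy Tψxy → divʳ (ψ x) (ψ y) Tψy (subst T (ψ-hom x y) Tψxy))

    generates-image : (∀ z → ∃ λ x → ψ x ≡ z) → ∀ {S S'} → (∀ w → S w → S' (ψ w)) →
                      Generates a b S → Generates a' b' S'
    generates-image ψ-surj S⊆ψ⁻¹S' gen z T T-sub S'⊆T with ψ-surj z
    ... | x , ψx≡z = subst T ψx≡z (gen x (T ∘ ψ) (preimage-isSubquasigroup T-sub) (λ w Sw → S'⊆T (ψ w) (S⊆ψ⁻¹S' w Sw)))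

  dilation : Carrier → Carrier → Carrier → Carrier
  dilation u k w = k * (w - u)

  [y-u]-[x-u]≡y-x : ∀ u x y → (y - u) - (x - u) ≡ y - x
  [y-u]-[x-u]≡y-x u x y = begin
    (y + - u) + - (x + - u)   ≡⟨ cong ((y + - u) +_) (⁻¹-anti-homo‿- x u) ⟩
    (y + - u) + (u + - x)     ≡⟨ solve 4 (λ y -u u -x → (y :+ -u) :+ (u :+ -x) := (y :+ -x) :+ (-u :+ u)) refl y (- u) u (- x) ⟩
    (y + - x) + (- u + u)     ≡⟨ cong ((y + - x) +_) (-‿inverseˡ u) ⟩
    (y + - x) + 0#            ≡⟨ +-identityʳ (y - x) ⟩
    y - x                     ∎

  dilation-isHom : ∀ {a b a' b' u k} → (∀ t → t ≢ 0# → slope a' b' (χ (k * t)) ≡ slope a b (χ t)) →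
                   IsHom a b a' b' (dilation u k)
  dilation-isHom {a} {b} {a'} {b'} {u} {k} slope-k x y with y ≟F x
  ... | yes refl = trans (cong ψ (Qop-idem x)) (sym (Qop-idem (ψ x)))
    where ψ = dilation u k
  ... | no y≢x = begin
    ψ (Qop a b x y)                                 ≡⟨ cong ψ (Qop-slope a b x y) ⟩
    ψ (x + s * t)                                   ≡⟨ solve 5 (λ k x s t -u → k :* ((x :+ s :* t) :+ -u) := k :* (x :+ -u) :+ s :* (k :* t)) refl k x s t (- u) ⟩
    ψ x + s * (k * t)                               ≡⟨ cong (λ e → ψ x + e * (k * t)) (sym (slope-k t (y≢x ∘ x-y≡0⇒x≡y))) ⟩
    ψ x + slope a' b' (χ (k * t)) * (k * t)         ≡⟨ cong (λ e → ψ x + slope a' b' (χ e) * e) ψy-ψx≡kt ⟩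
    ψ x + slope a' b' (χ (ψ y - ψ x)) * (ψ y - ψ x) ≡⟨ sym (Qop-slope a' b' (ψ x) (ψ y)) ⟩
    Qop a' b' (ψ x) (ψ y)                           ∎
    where
    ψ = dilation u k
    t = y - x
    s = slope a b (χ t)
    ψy-ψx≡kt : k * t ≡ ψ y - ψ x
    ψy-ψx≡kt = begin
      k * (y - x)                    ≡⟨ cong (k *_) (sym ([y-u]-[x-u]≡y-x u x y)) ⟩
      k * ((y - u) - (x - u))        ≡⟨ x[y-z]≈xy-xz k (y - u) (x - u) ⟩
      ψ y - ψ x                      ∎

  square-slope : ∀ {a b k} → k ≢ 0# → IsSquare k → ∀ t → slope a b (χ (k * t)) ≡ slope a b (χ t)
  square-slope {a} {b} {k} k≢0 □k t = cong (slope a b) (begin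
    χ (k * t)       ≡⟨ χ-* k t ⟩
    χ k *ℤ χ t      ≡⟨ cong (_*ℤ χ t) (χ-square k≢0 □k) ⟩
    1ℤ *ℤ χ t       ≡⟨ ℤ.*-identityˡ (χ t) ⟩
    χ t             ∎)

  nonsquare-slope : ∀ {a b k} → ¬ IsSquare k → ∀ t → t ≢ 0# → slope b a (χ (k * t)) ≡ slope a b (χ t)
  nonsquare-slope {a} {b} {k} ¬□k t t≢0 rewrite χ-* k t | χ-nonsquare ¬□k with isSquare? t
  ... | yes □t rewrite χ-square t≢0 □t = refl
  ... | no ¬□t rewrite χ-nonsquare ¬□t = refl

  normalise-generators : ∀ {a b a' b' u v d} → (v - u) * d ≡ 1# → IsHom a b a' b' (dilation u d) →
                         Generates a b (pair u v) → Generates a' b' (pair 0# 1#)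
  normalise-generators {u = u} {v} {d} cd≡1 ψ-hom = generates-image ψ-hom ψ-surjective sends-generators
    where
    ψ = dilation u d
    c = v - u
    ψ-surjective : ∀ z → ∃ λ x → ψ x ≡ z
    ψ-surjective z = c * z + u , (begin
      d * ((c * z + u) + - u)       ≡⟨ solve 5 (λ d c z u -u → d :* ((c :* z :+ u) :+ -u) := (c :* d) :* z :+ d :* (u :+ -u)) refl d c z u (- u) ⟩
      (c * d) * z + d * (u - u)     ≡⟨ cong₂ (λ p q → p * z + d * q) cd≡1 (-‿inverseʳ u) ⟩
      1# * z + d * 0#               ≡⟨ cong₂ _+_ (*-identityˡ z) (zeroʳ d) ⟩
      z + 0#                        ≡⟨ +-identityʳ z ⟩
      z                             ∎)
    sends-generators : ∀ w → pair u v w → pair 0# 1# (ψ w)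
    sends-generators w (inj₁ refl) = inj₁ (trans (cong (d *_) (-‿inverseʳ u)) (zeroʳ d))
    sends-generators w (inj₂ refl) = inj₂ (trans (*-comm d c) cd≡1)

lemma4p6 : (F : FiniteField) → let open FiniteField F in
    HasOddOrder F →
    (a b : Carrier) → Admissible a b →
    (∃ λ u → ∃ λ v → Generates a b (pair u v)) →
    Generates a b (pair 0# 1#) ⊎ Generates b a (pair 0# 1#)
lemma4p6 F _ a b adm (u , v , gen) = by-squareness (isSquare? d)
  where
  open FiniteField F
  open Quadratic F
  v-u≢0 : v - u ≢ 0#
  v-u≢0 = generators-distinct adm gen ∘ sym ∘ x-y≡0⇒x≡y
  d : Carrier
  d = proj₁ (inverse (v - u) v-u≢0)
  [v-u]d≡1 : (v - u) * d ≡ 1#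
  [v-u]d≡1 = proj₂ (inverse (v - u) v-u≢0)
  by-squareness : Dec (IsSquare d) → Generates a b (pair 0# 1#) ⊎ Generates b a (pair 0# 1#)
  by-squareness (yes □d) =
    inj₁ (normalise-generators [v-u]d≡1 (dilation-isHom (λ t _ → square-slope (x*y≡1⇒y≢0 [v-u]d≡1) □d t)) gen)
  by-squareness (no ¬□d) = inj₂ (normalise-generators [v-u]d≡1 (dilation-isHom (nonsquare-slope ¬□d)) gen)
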